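{- For $x \in \mathbb{C}$ and $n\in\mathbb{N}_0$, $$\sum_{k=1}^n k^4 H_k^{(4)}(x) = \frac{6x^5 + 15x^4 + 10x^3 - x - n + 10n^3 + 15n^4 + 6n^5}{30} H_n^{(4)}(x) - \frac{30x^2(x+1)^2 - 1}{30} H_n^{(3)}(x) + x(x+1)(2x+1)H_n^{(2)}(x) - \frac{6x^2 + 6x + 1}{3} H_n(x) + \frac{(8x + 4 - n)n}{10}.$$
   Context: For $x\in\mathbb{C}$, $l,n\in\mathbb{N}_0$, $H_0^{(l)}(x)=0$ and $H_n^{(l)}(x)=\sum_{k=1}^n \frac{1}{(x+k)^l}$ for $n\ge 1$ (defined whenever $x$ is not one of $-1,\dots,-n$); $H_n(x)=H_n^{(1)}(x)$. -}

module Defs where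

open import Level using (Level; suc; _⊔_)
open import Data.Nat using (ℕ; zero) renaming (suc to 1+)
open import Algebra.Bundles using (CommutativeRing)
open import Relation.Nullary using (¬_)

-- A field of characteristic zero (ℂ is an instance): a commutative ring
-- with a multiplicative inverse for every element not ≈ 0, in which
-- 1 + 1 + ... + 1 (n+1 times) is never 0.
-- canonical image of a natural number in a ring: ι 0 = 0, ι (n+1) = 1 + ι n
ιR : ∀ {c ℓ} (R : CommutativeRing c ℓ) → ℕ → CommutativeRing.Carrier R
ιR R zero = CommutativeRing.0# R
ιR R (1+ n) = CommutativeRing._+_ R (CommutativeRing.1# R) (ιR R n)

record CharZeroField (c ℓ : Level) : Set (suc (c ⊔ ℓ)) where
  field
    commutativeRing : CommutativeRing c ℓ
  open CommutativeRing commutativeRing public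
  field
    _⁻¹ : Carrier → Carrier
    ⁻¹-inverse : ∀ x → ¬ (x ≈ 0#) → x * (x ⁻¹) ≈ 1#
    charZero : ∀ n → ¬ (ιR commutativeRing (1+ n) ≈ 0#)

  ι : ℕ → Carrier
  ι = ιR commutativeRing

module _ {c ℓ : Level} (F : CharZeroField c ℓ) where
  open CharZeroField F

  pow : Carrier → ℕ → Carrier
  pow y zero = 1#
  pow y (1+ l) = y * pow y l

  sum1 : ℕ → (ℕ → Carrier) → Carrier
  sum1 zero f = 0#
  sum1 (1+ n) f = sum1 n f + f (1+ n)

  H : ℕ → ℕ → Carrier → Carrier
  H l n x = sum1 n (λ k → (pow (x + ι k) l) ⁻¹)

-- Write the right-hand side as
--   R(n) = c₄(n) H⁽⁴⁾ₙ - c₃ H⁽³⁾ₙ + c₂ H⁽²⁾ₙ - c₁ H⁽¹⁾ₙ + δ(n)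
-- with polynomial coefficients c₄(n), c₃, c₂, c₁, δ(n) in x and n (rational
-- constants 1/30, 1/3, 1/10).  For the step put y = x + n + 1 and a = 1/y⁴; then
-- H⁽ˡ⁾ₙ₊₁ = H⁽ˡ⁾ₙ + y^{4-l} a, so R(n+1) - R(n) collects into
--   (c₄(n+1) - c₄(n)) H⁽⁴⁾ₙ + [c₄(n+1) - c₃ y + c₂ y² - c₁ y³ + (δ(n+1) - δ(n)) y⁴] a
-- (using y⁴ a = 1), and two polynomial identities show that both brackets
-- equal (n+1)⁴; the first is Faulhaber's formula for Σ k⁴ in difference form.

module Submission where

open import Defs
open import Level using (Level)
open import Data.Nat using (ℕ; _≤_)
open import Relation.Nullary using (¬_; yes; no)
open import Data.Nat as ℕ using (zero; suc; s≤s; z≤n)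
import Data.Nat.Properties as ℕ
open import Data.Integer as ℤ using (ℤ; +_; -[1+_]; _⊖_; sign; ∣_∣; _◃_)
import Data.Integer.Properties as ℤ
open import Data.Sign as Sign using (Sign)
open import Data.Maybe using (just; nothing)
import Relation.Binary.PropositionalEquality as ≡
open import Relation.Binary.Definitions using (WeaklyDecidable)
open import Algebra.Bundles using (CommutativeRing)
open import Algebra.Solver.Ring.AlmostCommutativeRing
  using (fromCommutativeRing; _-Raw-AlmostCommutative⟶_; Induced-equivalence)

-- The canonical map ℤ → R into any commutative ring is a ring homomorphism;
-- this instantiates the ring solver over R with integer coefficients, so that
-- constants like ι 30 can be multiplied and added by normalisation.
module IntegerCoefficients {c ℓ : Level} (R : CommutativeRing c ℓ) where
  open CommutativeRing R
  open import Relation.Binary.Reasoning.Setoid setoid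
  open import Algebra.Properties.Ring ring using (-‿distribʳ-*; -‿+-comm; -1*x≈-x; -0#≈0#; -‿involutive)
  open import Algebra.Properties.CommutativeSemigroup +-commutativeSemigroup
    using () renaming (interchange to +-interchange)
  open import Algebra.Properties.CommutativeSemigroup *-commutativeSemigroup
    using () renaming (interchange to *-interchange)

  private
    ι : ℕ → Carrier
    ι = ιR R

  ι-+ : ∀ m n → ι (m ℕ.+ n) ≈ ι m + ι n
  ι-+ zero    n = sym (+-identityˡ _)
  ι-+ (suc m) n = trans (+-congˡ (ι-+ m n)) (sym (+-assoc _ _ _))

  ι-* : ∀ m n → ι (m ℕ.* n) ≈ ι m * ι n
  ι-* zero    n = sym (zeroˡ _)
  ι-* (suc m) n = begin
    ι (n ℕ.+ m ℕ.* n)     ≈⟨ ι-+ n (m ℕ.* n) ⟩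
    ι n + ι (m ℕ.* n)     ≈⟨ +-cong (sym (*-identityˡ _)) (ι-* m n) ⟩
    1# * ι n + ι m * ι n  ≈⟨ sym (distribʳ _ _ _) ⟩
    (1# + ι m) * ι n      ∎

  ⟦_⟧ℤ : ℤ → Carrier
  ⟦ + n ⟧ℤ     = ι n
  ⟦ -[1+ n ] ⟧ℤ = - ι (suc n)

  ⊖-homo : ∀ m n → ⟦ m ⊖ n ⟧ℤ ≈ ι m - ι n
  ⊖-homo zero    zero    = sym (-‿inverseʳ 0#)
  ⊖-homo zero    (suc n) = sym (+-identityˡ _)
  ⊖-homo (suc m) zero    = sym (trans (+-congˡ -0#≈0#) (+-identityʳ _))
  ⊖-homo (suc m) (suc n) = begin
    ⟦ suc m ⊖ suc n ⟧ℤ         ≡⟨ ≡.cong ⟦_⟧ℤ (ℤ.[1+m]⊖[1+n]≡m⊖n m n) ⟩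
    ⟦ m ⊖ n ⟧ℤ                 ≈⟨ ⊖-homo m n ⟩
    ι m - ι n                  ≈⟨ sym (+-identityˡ _) ⟩
    0# + (ι m - ι n)           ≈⟨ +-congʳ (sym (-‿inverseʳ 1#)) ⟩
    (1# - 1#) + (ι m - ι n)    ≈⟨ +-interchange 1# (- 1#) (ι m) (- ι n) ⟩
    (1# + ι m) + (- 1# - ι n)  ≈⟨ +-congˡ (-‿+-comm 1# (ι n)) ⟩
    (1# + ι m) - (1# + ι n)    ∎

  +-homo : ∀ i j → ⟦ i ℤ.+ j ⟧ℤ ≈ ⟦ i ⟧ℤ + ⟦ j ⟧ℤ
  +-homo (+ m)     (+ n)     = ι-+ m n
  +-homo (+ m)     -[1+ n ]  = ⊖-homo m (suc n)
  +-homo -[1+ m ]  (+ n)     = trans (⊖-homo n (suc m)) (+-comm _ _)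
  +-homo -[1+ m ]  -[1+ n ]  = begin
    - ι (suc (suc (m ℕ.+ n)))  ≡⟨ ≡.cong (λ k → - ι (suc k)) (≡.sym (ℕ.+-suc m n)) ⟩
    - ι (suc m ℕ.+ suc n)      ≈⟨ -‿cong (ι-+ (suc m) (suc n)) ⟩
    - (ι (suc m) + ι (suc n))  ≈⟨ sym (-‿+-comm _ _) ⟩
    - ι (suc m) - ι (suc n)    ∎

  ⟦_⟧ₛ : Sign → Carrier
  ⟦ Sign.+ ⟧ₛ = 1#
  ⟦ Sign.- ⟧ₛ = - 1#

  ◃-homo : ∀ s n → ⟦ s ◃ n ⟧ℤ ≈ ⟦ s ⟧ₛ * ι n
  ◃-homo s        zero    = sym (zeroʳ _)
  ◃-homo Sign.+   (suc n) = sym (*-identityˡ _)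
  ◃-homo Sign.-   (suc n) = sym (-1*x≈-x _)

  sign-*-homo : ∀ s t → ⟦ s Sign.* t ⟧ₛ ≈ ⟦ s ⟧ₛ * ⟦ t ⟧ₛ
  sign-*-homo Sign.+ t      = sym (*-identityˡ _)
  sign-*-homo Sign.- Sign.+ = sym (*-identityʳ _)
  sign-*-homo Sign.- Sign.- = begin
    1#               ≈⟨ sym (-‿involutive 1#) ⟩
    - - 1#           ≈⟨ -‿cong (sym (-1*x≈-x _)) ⟩
    - (- 1# * 1#)    ≈⟨ -‿distribʳ-* _ _ ⟩
    - 1# * - 1#      ∎

  sign-abs : ∀ i → ⟦ i ⟧ℤ ≈ ⟦ sign i ⟧ₛ * ι ∣ i ∣
  sign-abs i = trans (reflexive (≡.cong ⟦_⟧ℤ (≡.sym (ℤ.◃-inverse i)))) (◃-homo (sign i) ∣ i ∣)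

  *-homo : ∀ i j → ⟦ i ℤ.* j ⟧ℤ ≈ ⟦ i ⟧ℤ * ⟦ j ⟧ℤ
  *-homo i j = begin
    ⟦ (sign i Sign.* sign j) ◃ (∣ i ∣ ℕ.* ∣ j ∣) ⟧ℤ
      ≈⟨ ◃-homo (sign i Sign.* sign j) (∣ i ∣ ℕ.* ∣ j ∣) ⟩
    ⟦ sign i Sign.* sign j ⟧ₛ * ι (∣ i ∣ ℕ.* ∣ j ∣)
      ≈⟨ *-cong (sign-*-homo (sign i) (sign j)) (ι-* ∣ i ∣ ∣ j ∣) ⟩
    (⟦ sign i ⟧ₛ * ⟦ sign j ⟧ₛ) * (ι ∣ i ∣ * ι ∣ j ∣)
      ≈⟨ *-interchange _ _ _ _ ⟩
    (⟦ sign i ⟧ₛ * ι ∣ i ∣) * (⟦ sign j ⟧ₛ * ι ∣ j ∣)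
      ≈⟨ sym (*-cong (sign-abs i) (sign-abs j)) ⟩
    ⟦ i ⟧ℤ * ⟦ j ⟧ℤ ∎

  neg-homo : ∀ i → ⟦ ℤ.- i ⟧ℤ ≈ - ⟦ i ⟧ℤ
  neg-homo -[1+ n ]  = sym (-‿involutive _)
  neg-homo (+ zero)  = sym -0#≈0#
  neg-homo (+ suc n) = refl

  homomorphism : ℤ.+-*-rawRing -Raw-AlmostCommutative⟶ fromCommutativeRing R
  homomorphism = record
    { ⟦_⟧ = ⟦_⟧ℤ ; +-homo = +-homo ; *-homo = *-homo ; -‿homo = neg-homo
    ; 0-homo = refl ; 1-homo = +-identityʳ 1# }

  -- equal integer coefficients are recognised, so normal forms are canonical
  coefficient≟ : WeaklyDecidable (Induced-equivalence homomorphism)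
  coefficient≟ i j with i ℤ.≟ j
  ... | yes i≡j = just (reflexive (≡.cong ⟦_⟧ℤ i≡j))
  ... | no _    = nothing

  open import Algebra.Solver.Ring ℤ.+-*-rawRing (fromCommutativeRing R) homomorphism coefficient≟ public

  -- The constant polynomial with denotation 1# on the nose (con (+ 1)
  -- denotes ι 1 = 1# + 0#); it lets solver statements mention 1# and
  -- ι (suc n) = 1# + ι n literally.
  1ₚ : ∀ {k} → Polynomial k
  1ₚ = con (+ 0) :^ 0

module _ {c ℓ : Level} (F : CharZeroField c ℓ) where
  open CharZeroField F
  open IntegerCoefficients commutativeRing
  open import Relation.Binary.Reasoning.Setoid setoid

  1≉0 : ¬ (1# ≈ 0#)
  1≉0 1≈0 = charZero 0 (trans (+-identityʳ 1#) 1≈0)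

  *-nonzero : ∀ {a b} → ¬ a ≈ 0# → ¬ b ≈ 0# → ¬ (a * b ≈ 0#)
  *-nonzero {a} {b} a≉0 b≉0 ab≈0 = b≉0 (begin
    b                  ≈⟨ sym (*-identityˡ b) ⟩
    1# * b             ≈⟨ *-congʳ (sym (⁻¹-inverse a a≉0)) ⟩
    (a * a ⁻¹) * b     ≈⟨ *-congʳ (*-comm a (a ⁻¹)) ⟩
    (a ⁻¹ * a) * b     ≈⟨ *-assoc _ _ _ ⟩
    a ⁻¹ * (a * b)     ≈⟨ *-congˡ ab≈0 ⟩
    a ⁻¹ * 0#          ≈⟨ zeroʳ _ ⟩
    0#                 ∎)

  ⁻¹-unique : ∀ {a b} → a * b ≈ 1# → a ⁻¹ ≈ b
  ⁻¹-unique {a} {b} ab≈1 = begin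
    a ⁻¹               ≈⟨ sym (*-identityʳ _) ⟩
    a ⁻¹ * 1#          ≈⟨ *-congˡ (sym ab≈1) ⟩
    a ⁻¹ * (a * b)     ≈⟨ sym (*-assoc _ _ _) ⟩
    (a ⁻¹ * a) * b     ≈⟨ *-congʳ (*-comm _ _) ⟩
    (a * a ⁻¹) * b     ≈⟨ *-congʳ (⁻¹-inverse a a≉0) ⟩
    1# * b             ≈⟨ *-identityˡ b ⟩
    b                  ∎
    where
    a≉0 : ¬ a ≈ 0#
    a≉0 a≈0 = 1≉0 (trans (sym ab≈1) (trans (*-congʳ a≈0) (zeroˡ b)))

  ⁻¹-of-factor : ∀ {a b c} → a * b ≈ c → ¬ c ≈ 0# → a ⁻¹ ≈ b * c ⁻¹
  ⁻¹-of-factor {a} {b} {c} ab≈c c≉0 = ⁻¹-unique (begin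
    a * (b * c ⁻¹)     ≈⟨ sym (*-assoc _ _ _) ⟩
    (a * b) * c ⁻¹     ≈⟨ *-congʳ ab≈c ⟩
    c * c ⁻¹           ≈⟨ ⁻¹-inverse c c≉0 ⟩
    1#                 ∎)

  pow-+ : ∀ y l k → pow F y l * pow F y k ≈ pow F y (l ℕ.+ k)
  pow-+ y zero    k = *-identityˡ _
  pow-+ y (suc l) k = trans (*-assoc _ _ _) (*-congˡ (pow-+ y l k))

  pow-nonzero : ∀ {y} l → ¬ y ≈ 0# → ¬ (pow F y l ≈ 0#)
  pow-nonzero zero    y≉0 = 1≉0
  pow-nonzero (suc l) y≉0 = *-nonzero y≉0 (pow-nonzero l y≉0)

  -- 1/yˡ = yᵏ / y^{l+k}: every term of the harmonic sums over the
  -- fourth powers is expressed through the single inverse 1/y⁴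
  pow-⁻¹ : ∀ {y} l k → ¬ y ≈ 0# → (pow F y l) ⁻¹ ≈ pow F y k * (pow F y (l ℕ.+ k)) ⁻¹
  pow-⁻¹ l k y≉0 = ⁻¹-of-factor (pow-+ _ l k) (pow-nonzero (l ℕ.+ k) y≉0)

  w : Carrier
  w = (ι 30) ⁻¹

  30w≈1 : ι 30 * w ≈ 1#
  30w≈1 = ⁻¹-inverse (ι 30) (charZero 29)

  third : (ι 3) ⁻¹ ≈ ι 10 * w
  third = ⁻¹-of-factor (sym (ι-* 3 10)) (charZero 29)

  tenth : (ι 10) ⁻¹ ≈ ι 3 * w
  tenth = ⁻¹-of-factor (sym (ι-* 10 3)) (charZero 29)

  absorb : ∀ {e} u v → e ≈ 1# → u + v * (e - 1#) ≈ u
  absorb {e} u v e≈1 = begin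
    u + v * (e - 1#)   ≈⟨ +-congˡ (*-congˡ (trans (+-congʳ e≈1) (-‿inverseʳ 1#))) ⟩
    u + v * 0#         ≈⟨ +-congˡ (zeroʳ v) ⟩
    u + 0#             ≈⟨ +-identityʳ u ⟩
    u                  ∎

  c₄ : Carrier → Carrier → Carrier
  c₄ N x = (ι 6 * pow F x 5 + ι 15 * pow F x 4 + ι 10 * pow F x 3 - x - N
            + ι 10 * pow F N 3 + ι 15 * pow F N 4 + ι 6 * pow F N 5) * w

  c₃ : Carrier → Carrier
  c₃ x = (ι 30 * pow F x 2 * pow F (x + 1#) 2 - 1#) * w

  c₂ : Carrier → Carrier
  c₂ x = x * (x + 1#) * (ι 2 * x + 1#)

  c₁ : Carrier → Carrier
  c₁ x = (ι 6 * pow F x 2 + ι 6 * x + 1#) * (ι 3) ⁻¹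

  δ : Carrier → Carrier → Carrier
  δ N x = (ι 8 * x + ι 4 - N) * N * (ι 10) ⁻¹

  closedForm : ℕ → Carrier → Carrier
  closedForm n x = c₄ (ι n) x * H F 4 n x - c₃ x * H F 3 n x + c₂ x * H F 2 n x
                   - c₁ x * H F 1 n x + δ (ι n) x

  -- The coefficients as polynomials in x, N and w = 1/30, for the solver
  -- (with 1/3 written as 10 w and 1/10 as 3 w).

  c₄ₚ : ∀ {k} → Polynomial k → Polynomial k → Polynomial k → Polynomial k
  c₄ₚ N x w = (con (+ 6) :* x :^ 5 :+ con (+ 15) :* x :^ 4 :+ con (+ 10) :* x :^ 3 :- x :- N
              :+ con (+ 10) :* N :^ 3 :+ con (+ 15) :* N :^ 4 :+ con (+ 6) :* N :^ 5) :* w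

  c₃ₚ : ∀ {k} → Polynomial k → Polynomial k → Polynomial k
  c₃ₚ x w = (con (+ 30) :* x :^ 2 :* (x :+ 1ₚ) :^ 2 :- 1ₚ) :* w

  c₂ₚ : ∀ {k} → Polynomial k → Polynomial k
  c₂ₚ x = x :* (x :+ 1ₚ) :* (con (+ 2) :* x :+ 1ₚ)

  c₁ₚ : ∀ {k} → Polynomial k → Polynomial k → Polynomial k
  c₁ₚ x w = (con (+ 6) :* x :^ 2 :+ con (+ 6) :* x :+ 1ₚ) :* (con (+ 10) :* w)

  δₚ : ∀ {k} → Polynomial k → Polynomial k → Polynomial k → Polynomial k
  δₚ N x w = (con (+ 8) :* x :+ con (+ 4) :- N) :* N :* (con (+ 3) :* w)

  -- Faulhaber in difference form:  c₄(N+1) - c₄(N) = (N+1)⁴,  since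
  -- 6N⁵ + 15N⁴ + 10N³ - N increases by 30 (N+1)⁴.
  c₄-difference : ∀ N x → c₄ (1# + N) x - c₄ N x ≈ pow F (1# + N) 4
  c₄-difference N x = begin
    c₄ (1# + N) x - c₄ N x
      ≈⟨ identity x N ⟩
    pow F (1# + N) 4 + pow F (1# + N) 4 * (ι 30 * w - 1#)
      ≈⟨ absorb _ _ 30w≈1 ⟩
    pow F (1# + N) 4 ∎
    where
    identity : ∀ x N → c₄ (1# + N) x - c₄ N x
                         ≈ pow F (1# + N) 4 + pow F (1# + N) 4 * (ι 30 * w - 1#)
    identity x N = solve 3 (λ x N w →
      c₄ₚ (1ₚ :+ N) x w :- c₄ₚ N x w
        := (1ₚ :+ N) :^ 4 :+ (1ₚ :+ N) :^ 4 :* (con (+ 30) :* w :- 1ₚ)) refl x N w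

  -- The terms of R(n+1) - R(n) carrying 1/y⁴ (y = x + n + 1) add up to (n+1)⁴ / y⁴:
  --   c₄(N+1) - c₃ y + c₂ y² - c₁ y³ + (δ(N+1) - δ(N)) y⁴ = (N+1)⁴.
  new-term : ∀ N x →
    c₄ (1# + N) x - c₃ x * (x + (1# + N)) + c₂ x * pow F (x + (1# + N)) 2
      - c₁ x * pow F (x + (1# + N)) 3 + (δ (1# + N) x - δ N x) * pow F (x + (1# + N)) 4
    ≈ pow F (1# + N) 4
  new-term N x = begin
    c₄ (1# + N) x - c₃ x * y + c₂ x * pow F y 2 - c₁ x * pow F y 3
      + (δ (1# + N) x - δ N x) * pow F y 4
      ≈⟨ +-cong (+-congˡ (-‿cong (*-congʳ (*-congˡ third))))
                (*-congʳ (+-cong (*-congˡ tenth) (-‿cong (*-congˡ tenth)))) ⟩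
    c₄ (1# + N) x - c₃ x * y + c₂ x * pow F y 2
      - (ι 6 * pow F x 2 + ι 6 * x + 1#) * (ι 10 * w) * pow F y 3
      + ((ι 8 * x + ι 4 - (1# + N)) * (1# + N) * (ι 3 * w)
         - (ι 8 * x + ι 4 - N) * N * (ι 3 * w)) * pow F y 4
      ≈⟨ identity x N ⟩
    pow F (1# + N) 4 + (pow F (1# + N) 4 - c₂ x * pow F y 2) * (ι 30 * w - 1#)
      ≈⟨ absorb _ _ 30w≈1 ⟩
    pow F (1# + N) 4 ∎
    where
    y : Carrier
    y = x + (1# + N)

    identity : ∀ x N →
      c₄ (1# + N) x - c₃ x * (x + (1# + N)) + c₂ x * pow F (x + (1# + N)) 2
        - (ι 6 * pow F x 2 + ι 6 * x + 1#) * (ι 10 * w) * pow F (x + (1# + N)) 3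
        + ((ι 8 * x + ι 4 - (1# + N)) * (1# + N) * (ι 3 * w)
           - (ι 8 * x + ι 4 - N) * N * (ι 3 * w)) * pow F (x + (1# + N)) 4
      ≈ pow F (1# + N) 4
        + (pow F (1# + N) 4 - c₂ x * pow F (x + (1# + N)) 2) * (ι 30 * w - 1#)
    identity x N = solve 3 (λ x N w → let y = x :+ (1ₚ :+ N) in
      c₄ₚ (1ₚ :+ N) x w :- c₃ₚ x w :* y :+ c₂ₚ x :* y :^ 2 :- c₁ₚ x w :* y :^ 3
        :+ (δₚ (1ₚ :+ N) x w :- δₚ N x w) :* y :^ 4
      := (1ₚ :+ N) :^ 4 :+ ((1ₚ :+ N) :^ 4 :- c₂ₚ x :* y :^ 2) :* (con (+ 30) :* w :- 1ₚ))
      refl x N w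

  -- R(n+1) regrouped around R(n), for any values of the coefficients: the
  -- increments of the harmonic sums are the multiples yᵏ a of a = 1/y⁴, and
  -- the difference of the constant terms is absorbed using y⁴ a = 1.
  regroup : ∀ C₄′ C₄ C₃ C₂ C₁ D′ D h₄ h₃ h₂ h₁ y a →
    C₄′ * (h₄ + a) - C₃ * (h₃ + pow F y 1 * a) + C₂ * (h₂ + pow F y 2 * a)
      - C₁ * (h₁ + pow F y 3 * a) + D′
    ≈ (C₄ * h₄ - C₃ * h₃ + C₂ * h₂ - C₁ * h₁ + D) + (C₄′ - C₄) * h₄
      + (C₄′ - C₃ * y + C₂ * pow F y 2 - C₁ * pow F y 3 + (D′ - D) * pow F y 4) * a
      + (D - D′) * (pow F y 4 * a - 1#)
  regroup = solve 13 (λ C₄′ C₄ C₃ C₂ C₁ D′ D h₄ h₃ h₂ h₁ y a →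
    C₄′ :* (h₄ :+ a) :- C₃ :* (h₃ :+ y :^ 1 :* a) :+ C₂ :* (h₂ :+ y :^ 2 :* a)
      :- C₁ :* (h₁ :+ y :^ 3 :* a) :+ D′
    := (C₄ :* h₄ :- C₃ :* h₃ :+ C₂ :* h₂ :- C₁ :* h₁ :+ D) :+ (C₄′ :- C₄) :* h₄
      :+ (C₄′ :- C₃ :* y :+ C₂ :* y :^ 2 :- C₁ :* y :^ 3 :+ (D′ :- D) :* y :^ 4) :* a
      :+ (D :- D′) :* (y :^ 4 :* a :- 1ₚ)) refl

  closedForm-step : ∀ n x → ¬ (x + ι (suc n) ≈ 0#) →
    closedForm (suc n) x ≈ closedForm n x + pow F (ι (suc n)) 4 * H F 4 (suc n) x
  closedForm-step n x y≉0 = begin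
    closedForm (suc n) x
      ≈⟨ +-congʳ (+-cong (+-cong (+-congˡ (-‿cong (*-congˡ (+-congˡ (pow-⁻¹ 3 1 y≉0)))))
                                 (*-congˡ (+-congˡ (pow-⁻¹ 2 2 y≉0))))
                         (-‿cong (*-congˡ (+-congˡ (pow-⁻¹ 1 3 y≉0))))) ⟩
    c₄ N′ x * (h₄ + a) - c₃ x * (h₃ + pow F y 1 * a) + c₂ x * (h₂ + pow F y 2 * a)
      - c₁ x * (h₁ + pow F y 3 * a) + δ N′ x
      ≈⟨ regroup (c₄ N′ x) (c₄ N x) (c₃ x) (c₂ x) (c₁ x) (δ N′ x) (δ N x) h₄ h₃ h₂ h₁ y a ⟩
    closedForm n x + (c₄ N′ x - c₄ N x) * h₄
      + (c₄ N′ x - c₃ x * y + c₂ x * pow F y 2 - c₁ x * pow F y 3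
         + (δ N′ x - δ N x) * pow F y 4) * a
      + (δ N x - δ N′ x) * (pow F y 4 * a - 1#)
      ≈⟨ absorb _ _ (⁻¹-inverse _ (pow-nonzero 4 y≉0)) ⟩
    closedForm n x + (c₄ N′ x - c₄ N x) * h₄
      + (c₄ N′ x - c₃ x * y + c₂ x * pow F y 2 - c₁ x * pow F y 3
         + (δ N′ x - δ N x) * pow F y 4) * a
      ≈⟨ +-cong (+-congˡ (*-congʳ (c₄-difference N x))) (*-congʳ (new-term N x)) ⟩
    closedForm n x + M * h₄ + M * a
      ≈⟨ trans (+-assoc _ _ _) (+-congˡ (sym (distribˡ M h₄ a))) ⟩
    closedForm n x + M * (h₄ + a) ∎
    where
    N N′ y a M h₁ h₂ h₃ h₄ : Carrier
    N  = ι n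
    N′ = ι (suc n)
    y  = x + N′
    a  = (pow F y 4) ⁻¹
    M  = pow F N′ 4
    h₁ = H F 1 n x
    h₂ = H F 2 n x
    h₃ = H F 3 n x
    h₄ = H F 4 n x

  closedForm-zero : ∀ x → closedForm 0 x ≈ 0#
  closedForm-zero x = identity (c₄ 0# x) (c₃ x) (c₂ x) (c₁ x) (ι 8 * x + ι 4 - 0#) ((ι 10) ⁻¹)
    where
    identity : ∀ A B C D E G → A * 0# - B * 0# + C * 0# - D * 0# + E * 0# * G ≈ 0#
    identity = solve 6 (λ A B C D E G →
      A :* con (+ 0) :- B :* con (+ 0) :+ C :* con (+ 0) :- D :* con (+ 0) :+ E :* con (+ 0) :* G
      := con (+ 0)) refl

  closed-form : ∀ n x → (∀ k → 1 ≤ k → k ≤ n → ¬ (x + ι k ≈ 0#)) →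
    sum1 F n (λ k → pow F (ι k) 4 * H F 4 k x) ≈ closedForm n x
  closed-form zero    x _  = sym (closedForm-zero x)
  closed-form (suc n) x nz = begin
    sum1 F n (λ k → pow F (ι k) 4 * H F 4 k x) + pow F (ι (suc n)) 4 * H F 4 (suc n) x
      ≈⟨ +-congʳ (closed-form n x (λ k 1≤k k≤n → nz k 1≤k (ℕ.m≤n⇒m≤1+n k≤n))) ⟩
    closedForm n x + pow F (ι (suc n)) 4 * H F 4 (suc n) x
      ≈⟨ sym (closedForm-step n x (nz (suc n) (s≤s z≤n) ℕ.≤-refl)) ⟩
    closedForm (suc n) x ∎

proposition27 : ∀ {c ℓ : Level} (F : CharZeroField c ℓ) →
    let open CharZeroField F in
    ∀ (n : ℕ) (x : Carrier) →
    (∀ k → 1 ≤ k → k ≤ n → ¬ (x + ι k ≈ 0#)) →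
    sum1 F n (λ k → pow F (ι k) 4 * H F 4 k x)
      ≈ (ι 6 * pow F x 5 + ι 15 * pow F x 4 + ι 10 * pow F x 3 - x - ι n
          + ι 10 * pow F (ι n) 3 + ι 15 * pow F (ι n) 4 + ι 6 * pow F (ι n) 5)
          * (ι 30) ⁻¹ * H F 4 n x
        - (ι 30 * pow F x 2 * pow F (x + 1#) 2 - 1#) * (ι 30) ⁻¹ * H F 3 n x
        + x * (x + 1#) * (ι 2 * x + 1#) * H F 2 n x
        - (ι 6 * pow F x 2 + ι 6 * x + 1#) * (ι 3) ⁻¹ * H F 1 n x
        + (ι 8 * x + ι 4 - ι n) * ι n * (ι 10) ⁻¹
proposition27 = closed-form
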